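{- Let $G$ be a finite simple connected graph with at least two vertices. Then $o(G\circ K_2)\in\{\mathcal{R},\mathcal{S}\}$. Moreover: if $G$ has true twins, then $S_{\rm MB}(G\circ K_2)=S_{\rm MB}'(G\circ K_2)=2$; if $G$ has no true twins, then $R_{\rm MB}(G\circ K_2)=R_{\rm MB}'(G\circ K_2)=n(G)$.
   Context: $n(G)$ is the number of vertices of $G$; $K_2$ is the complete graph on two vertices. Vertices $u\neq v$ are twins if $N(u)\setminus\{v\}=N(v)\setminus\{u\}$ (open neighborhoods); adjacent twins are true twins. The lexicographic product $G\circ H$ has vertex set $V(G)\times V(H)$, with $(g,h)(g',h')$ an edge iff $gg'\in E(G)$, or $g=g'$ and $hh'\in E(H)$. A set $W\subseteq V(X)$ is a resolving set of a connected graph $X$ if for every two distinct vertices $x,y$ there is $z\in W$ with $d(x,z)\ne d(y,z)$. In the Maker-Breaker resolving game on $X$, Resolver and Spoiler alternately select unplayed vertices of $X$; Resolver wins if the vertices he selects contain a resolving set of $X$, and Spoiler wins if she selects at least one vertex of every resolving set of $X$. The R-game has Resolver moving first; the S-game has Spoiler moving first. The outcome $o(X)$ is $\mathcal{R}$ if Resolver has a winning strategy no matter who starts, $\mathcal{S}$ if Spoiler has a winning strategy no matter who starts, and $\mathcal{N}$ if the first player has a winning strategy. $R_{\rm MB}(X)$ (resp. $R_{\rm MB}'(X)$) is the minimum number of moves Resolver needs to win the R-game (resp. S-game) under optimal play; $S_{\rm MB}(X)$ (resp. $S_{\rm MB}'(X)$) is the minimum number of moves Spoiler needs to win the R-game (resp.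 S-game) under optimal play. -}

module Defs where

open import Data.Nat using (ℕ; zero; suc; _*_; _<_)
open import Data.Fin using (Fin; remQuot)
open import Data.Fin.Subset using (Subset; _∈_; _∉_; _∪_; ⁅_⁆; ⊥)
open import Data.Product using (Σ; ∃; _×_; _,_; proj₁; proj₂)
open import Data.Sum using (_⊎_)
open import Relation.Binary.PropositionalEquality using (_≡_; _≢_)
open import Relation.Nullary using (¬_; Dec)
open import Function.Bundles using (_⇔_)

record Graph (n : ℕ) : Set₁ where
  field
    E     : Fin n → Fin n → Set
    E-dec : ∀ u v → Dec (E u v)
    E-sym : ∀ {u v} → E u v → E v u
    E-irr : ∀ u → ¬ E u u
open Graph public

nV : ∀ {n} → Graph n → ℕ
nV {n} _ = n

data Walk {n} (G : Graph n) : Fin n → Fin n → ℕ → Set where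
  here : ∀ {x} → Walk G x x 0
  step : ∀ {x y z k} → E G x y → Walk G y z k → Walk G x z (suc k)

Connected : ∀ {n} → Graph n → Set
Connected G = ∀ x y → ∃ λ k → Walk G x y k

Dist : ∀ {n} → Graph n → Fin n → Fin n → ℕ → Set
Dist G x y k = Walk G x y k × (∀ j → j < k → ¬ Walk G x y j)

Resolving : ∀ {n} → Graph n → Subset n → Set
Resolving G W = ∀ x y → x ≢ y →
  Σ _ λ z → z ∈ W × Σ ℕ λ a → Σ ℕ λ b → Dist G x z a × Dist G y z b × a ≢ b

HasTrueTwins : ∀ {n} → Graph n → Set
HasTrueTwins G = Σ _ λ u → Σ _ λ v → u ≢ v × E G u v ×
  (∀ w → (E G u w × w ≢ v) ⇔ (E G v w × w ≢ u))

K₂ : Graph 2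
K₂ = record { E = λ u v → u ≢ v ; E-dec = dec ; E-sym = λ p q → p (Relation.Binary.PropositionalEquality.sym q) ; E-irr = λ u p → p Relation.Binary.PropositionalEquality.refl }
  where
  open import Data.Fin.Properties using (_≟_)
  open import Relation.Nullary using (yes; no)
  dec : ∀ (u v : Fin 2) → Dec (u ≢ v)
  dec u v with u ≟ v
  ... | yes p = no (λ q → q p)
  ... | no q = yes q

-- lexicographic product; vertex i of G ∘ H is the pair (fstV i , sndV i) ∈ Fin m × Fin n
-- (via the bijection remQuot : Fin (m * n) → Fin m × Fin n, inverse combine)
fstV : ∀ {m} n → Fin (m * n) → Fin m
fstV {m} n i = proj₁ (remQuot {m} n i)

sndV : ∀ {m} n → Fin (m * n) → Fin n
sndV {m} n i = proj₂ (remQuot {m} n i)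

LexE : ∀ {m n} → Graph m → Graph n → Fin (m * n) → Fin (m * n) → Set
LexE {m} {n} G H i j =
  E G (fstV {m} n i) (fstV {m} n j)
  ⊎ (fstV {m} n i ≡ fstV {m} n j × E H (sndV {m} n i) (sndV {m} n j))

module _ where
  open import Data.Fin.Properties using (_≟_)
  open import Relation.Nullary using (yes; no)
  open import Data.Sum using (inj₁; inj₂)
  open import Relation.Binary.PropositionalEquality using (sym; refl)

  _∘ᴳ_ : ∀ {m n} → Graph m → Graph n → Graph (m * n)
  _∘ᴳ_ {m} {n} G H = record { E = LexE G H ; E-dec = dec ; E-sym = sy ; E-irr = ir }
    where
    dec : ∀ i j → Dec (LexE G H i j)
    dec i j with E-dec G (fstV {m} n i) (fstV {m} n j)
    ... | yes p = yes (inj₁ p)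
    ... | no ¬p with fstV {m} n i ≟ fstV {m} n j
                   | E-dec H (sndV {m} n i) (sndV {m} n j)
    ... | yes e | yes h = yes (inj₂ (e , h))
    ... | no ¬e | _ = no λ { (inj₁ p) → ¬p p ; (inj₂ (e , _)) → ¬e e }
    ... | yes _ | no ¬h = no λ { (inj₁ p) → ¬p p ; (inj₂ (_ , h)) → ¬h h }
    sy : ∀ {i j} → LexE G H i j → LexE G H j i
    sy (inj₁ p) = inj₁ (E-sym G p)
    sy (inj₂ (e , h)) = inj₂ (sym e , E-sym H h)
    ir : ∀ i → ¬ LexE G H i i
    ir i (inj₁ p) = E-irr G _ p
    ir i (inj₂ (_ , h)) = E-irr H _ h

-- Maker–Breaker resolving game.  A position is (R , S): the vertices
-- chosen so far by Resolver and by Spoiler.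

Free : ∀ {n} → Subset n → Subset n → Fin n → Set
Free R S v = v ∉ R × v ∉ S

Blocks : ∀ {n} → Graph n → Subset n → Set
Blocks G S = ∀ W → Resolving G W → Σ _ λ v → v ∈ W × v ∈ S

-- Resolver can force a win using at most k further moves of his own.
mutual
  ResWinR : ∀ {n} → Graph n → ℕ → Subset n → Subset n → Set
  ResWinR G zero R S = Resolving G R
  ResWinR G (suc k) R S =
    Resolving G R ⊎ (Σ _ λ v → Free R S v × ResWinS G k (R ∪ ⁅ v ⁆) S)

  -- Spoiler to move (game over if no free vertex remains)
  ResWinS : ∀ {n} → Graph n → ℕ → Subset n → Subset n → Set
  ResWinS G k R S =
    Resolving G R ⊎ ((Σ _ λ v → Free R S v) × (∀ v → Free R S v → ResWinR G k R (S ∪ ⁅ v ⁆)))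

-- Spoiler can force a win using at most k further moves of her own.
mutual
  SpoWinS : ∀ {n} → Graph n → ℕ → Subset n → Subset n → Set
  SpoWinS G zero R S = Blocks G S
  SpoWinS G (suc k) R S =
    Blocks G S ⊎ (Σ _ λ v → Free R S v × SpoWinR G k R (S ∪ ⁅ v ⁆))

  -- Resolver to move (game over if no free vertex remains)
  SpoWinR : ∀ {n} → Graph n → ℕ → Subset n → Subset n → Set
  SpoWinR G k R S =
    Blocks G S ⊎ ((Σ _ λ v → Free R S v) × (∀ v → Free R S v → SpoWinS G k (R ∪ ⁅ v ⁆) S))

-- Games from the empty position. R-game: Resolver first; S-game: Spoiler first.
ResolverWinsIn-R-game ResolverWinsIn-S-game SpoilerWinsIn-R-game SpoilerWinsIn-S-game
  : ∀ {n} → Graph n → ℕ → Set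
ResolverWinsIn-R-game G k = ResWinR G k ⊥ ⊥
ResolverWinsIn-S-game G k = ResWinS G k ⊥ ⊥
SpoilerWinsIn-R-game  G k = SpoWinR G k ⊥ ⊥
SpoilerWinsIn-S-game  G k = SpoWinS G k ⊥ ⊥

data Outcome : Set where
  𝓡 𝓢 𝓝 : Outcome

HasOutcome : ∀ {n} → Graph n → Outcome → Set
HasOutcome G 𝓡 = (∃ λ k → ResolverWinsIn-R-game G k) × (∃ λ k → ResolverWinsIn-S-game G k)
HasOutcome G 𝓢 = (∃ λ k → SpoilerWinsIn-R-game G k) × (∃ λ k → SpoilerWinsIn-S-game G k)
HasOutcome G 𝓝 = (∃ λ k → ResolverWinsIn-R-game G k) × (∃ λ k → SpoilerWinsIn-S-game G k)

IsMin : (ℕ → Set) → ℕ → Set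
IsMin P zero = P zero
IsMin P (suc m) = P (suc m) × ¬ P m

R-MB R-MB′ S-MB S-MB′ : ∀ {n} → Graph n → ℕ → Set
R-MB  G = IsMin (ResolverWinsIn-R-game G)
R-MB′ G = IsMin (ResolverWinsIn-S-game G)
S-MB  G = IsMin (SpoilerWinsIn-R-game G)
S-MB′ G = IsMin (SpoilerWinsIn-S-game G)

{-# OPTIONS --safe #-}

-- In G ∘ K₂ the two copies (g , 0) and (g , 1) of a vertex g are twins, and twins are told
-- apart only by themselves; so every resolving set meets each of the n pairs, and Resolver
-- needs at least n moves. If G has no true twins, conversely every set meeting all pairs is
-- resolving: two vertices over distinct g, h are separated by a vertex over some w lying in
-- exactly one of the closed neighbourhoods N[g], N[h]. The pairing strategy (answer Spoiler
-- inside her pair) then wins for Resolver in n moves. If u, v are true twins of G, the four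
-- vertices over u and v are pairwise twins, so Spoiler wins as soon as she owns two of them,
-- which she can force in two moves. One move never suffices, because the complement of a
-- single vertex resolves any connected graph.

module Submission where

open import Defs
open import Data.Nat using (ℕ; _≤_)
open import Data.Product using (_×_)
open import Data.Sum using (_⊎_)
open import Relation.Nullary using (¬_)

open import Data.Nat using (zero; suc; _*_; _<_; z≤n; s≤s)
open import Data.Nat.Properties using (anyUpTo?; ≮⇒≥; ≤-trans; ≤-antisym; ≤-pred; ≤-reflexive; <-≤-trans; n≤1+n; 1+n≰n; <⇒≱; m≤n⇒m≤1+n)
open import Data.Nat.Induction using (<-rec)
open import Data.Fin using (Fin; combine; quotient; remainder; opposite)
open import Data.Fin.Patterns using (0F; 1F)
open import Data.Fin.Properties using (_≟_; any?; all?; ¬∀⟶∃¬; injective⇒≤; remQuot-combine; combine-remQuot; combine-injectiveˡ; combine-injectiveʳ)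
open import Data.Fin.Subset using (Subset; _∈_; _∉_; _∪_; ⁅_⁆; ∁; ⊥)
open import Data.Fin.Subset.Properties using (_∈?_; ∉⊥; x∈⁅x⁆; x∈⁅y⁆⇒x≡y; x∈p∪q⁻; x∈p∪q⁺; x∈∁p⇒x∉p; x∉p⇒x∈∁p)
open import Data.List using (List; []; _∷_; length; lookup; filter; allFin)
open import Data.List.Properties using (length-tabulate; filter-notAll)
open import Data.List.Membership.Propositional using () renaming (_∈_ to _∈ₗ_; _∉_ to _∉ₗ_)
open import Data.List.Membership.Propositional.Properties using (∈-allFin; ∈-filter⁺)
import Data.List.Relation.Unary.Any as Any
open import Data.List.Relation.Unary.Any.Properties using (lookup-index)
open import Data.Product using (Σ; ∃; ∃₂; _,_; proj₁; proj₂; map; map₂)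
open import Data.Sum using (inj₁; inj₂; [_,_])
open import Data.Empty using (⊥-elim)
open import Function using (_∘_)
open import Function.Bundles using (mk⇔; Equivalence)
open import Function.Definitions using (Injective)
open import Relation.Nullary using (Dec; yes; no; ¬?)
open import Relation.Nullary.Decidable using (_×-dec_; _⊎-dec_; _→-dec_; map′)
open import Relation.Unary using (Decidable)
open import Relation.Binary.PropositionalEquality using (_≡_; _≢_; refl; sym; trans; cong; cong₂; subst; subst₂; ≢-sym; module ≡-Reasoning)

fin2-cases : ∀ {a b : Fin 2} → a ≢ b → ∀ c → c ≡ a ⊎ c ≡ b
fin2-cases {0F} {0F} a≢b _  = ⊥-elim (a≢b refl)
fin2-cases {1F} {1F} a≢b _  = ⊥-elim (a≢b refl)
fin2-cases {0F} {1F} _   0F = inj₁ refl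
fin2-cases {0F} {1F} _   1F = inj₂ refl
fin2-cases {1F} {0F} _   0F = inj₂ refl
fin2-cases {1F} {0F} _   1F = inj₁ refl

opposite-≢ : ∀ (a : Fin 2) → opposite a ≢ a
opposite-≢ 0F ()
opposite-≢ 1F ()

injective⇒≤length : ∀ {A : Set} {k} {L : List A} (q : Fin k → A) →
                    Injective _≡_ _≡_ q → (∀ i → q i ∈ₗ L) → k ≤ length L
injective⇒≤length {L = L} q q-injective q∈L = injective⇒≤ position-injective
  where
  open ≡-Reasoning
  position-injective : Injective _≡_ _≡_ (Any.index ∘ q∈L)
  position-injective {i} {j} same = q-injective (begin
    q i                       ≡⟨ lookup-index (q∈L i) ⟩
    lookup L (Any.index (q∈L i)) ≡⟨ cong (lookup L) same ⟩
    lookup L (Any.index (q∈L j)) ≡⟨ lookup-index (q∈L j) ⟨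
    q j                       ∎)

module _ {N : ℕ} where

  open import Data.List.Membership.DecPropositional (_≟_ {N}) using () renaming (_∈?_ to _∈ₗ?_)

  ∈-∪⁅⁆ : ∀ (p : Subset N) y → y ∈ p ∪ ⁅ y ⁆
  ∈-∪⁅⁆ p y = x∈p∪q⁺ (inj₂ (x∈⁅x⁆ y))

  ∈-∪⁅⁆⁻ : ∀ {p : Subset N} {x y} → x ∈ p ∪ ⁅ y ⁆ → x ∈ p ⊎ x ≡ y
  ∈-∪⁅⁆⁻ {p} {y = y} x∈ with x∈p∪q⁻ p ⁅ y ⁆ x∈
  ... | inj₁ x∈p = inj₁ x∈p
  ... | inj₂ x∈y = inj₂ (x∈⁅y⁆⇒x≡y y x∈y)

  ∉-∪⁅⁆ : ∀ {p : Subset N} {x y} → x ∉ p → x ≢ y → x ∉ p ∪ ⁅ y ⁆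
  ∉-∪⁅⁆ x∉p x≢y x∈ with ∈-∪⁅⁆⁻ x∈
  ... | inj₁ x∈p = x∉p x∈p
  ... | inj₂ x≡y = x≢y x≡y

  Subsingleton : Subset N → Set
  Subsingleton S = ∀ {x y} → x ∈ S → y ∈ S → x ≡ y

  ⊥-subsingleton : Subsingleton ⊥
  ⊥-subsingleton x∈⊥ = ⊥-elim (∉⊥ x∈⊥)

  ⊥∪⁅⁆-subsingleton : ∀ v → Subsingleton (⊥ ∪ ⁅ v ⁆)
  ⊥∪⁅⁆-subsingleton v x∈ y∈ = trans (∈-⊥∪⁅⁆ x∈) (sym (∈-⊥∪⁅⁆ y∈))
    where
    ∈-⊥∪⁅⁆ : ∀ {x} → x ∈ ⊥ ∪ ⁅ v ⁆ → x ≡ v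
    ∈-⊥∪⁅⁆ x∈ with ∈-∪⁅⁆⁻ x∈
    ... | inj₁ x∈⊥ = ⊥-elim (∉⊥ x∈⊥)
    ... | inj₂ x≡v = x≡v

  Claimed : List (Fin N) → Subset N → Subset N → Set
  Claimed L R S = ∀ {x} → x ∈ R ⊎ x ∈ S → x ∈ₗ L

  claimed-⊥ : Claimed [] ⊥ ⊥
  claimed-⊥ (inj₁ x∈⊥) = ⊥-elim (∉⊥ x∈⊥)
  claimed-⊥ (inj₂ x∈⊥) = ⊥-elim (∉⊥ x∈⊥)

  claimed-R : ∀ {L R S w} → Claimed L R S → Claimed (w ∷ L) (R ∪ ⁅ w ⁆) S
  claimed-R claimed (inj₂ x∈S) = Any.there (claimed (inj₂ x∈S))
  claimed-R claimed (inj₁ x∈R∪w) with ∈-∪⁅⁆⁻ x∈R∪w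
  ... | inj₁ x∈R = Any.there (claimed (inj₁ x∈R))
  ... | inj₂ x≡w = Any.here x≡w

  claimed-S : ∀ {L R S v} → Claimed L R S → Claimed (v ∷ L) R (S ∪ ⁅ v ⁆)
  claimed-S claimed (inj₁ x∈R) = Any.there (claimed (inj₁ x∈R))
  claimed-S claimed (inj₂ x∈S∪v) with ∈-∪⁅⁆⁻ x∈S∪v
  ... | inj₁ x∈S = Any.there (claimed (inj₂ x∈S))
  ... | inj₂ x≡v = Any.here x≡v

  unclaimed⇒free : ∀ {L R S x} → Claimed L R S → x ∉ₗ L → Free R S x
  unclaimed⇒free claimed x∉L = x∉L ∘ claimed ∘ inj₁ , x∉L ∘ claimed ∘ inj₂

  free-∪⁅⁆ : ∀ {R S : Subset N} {w v} → Free R S w → w ≢ v → Free R (S ∪ ⁅ v ⁆) w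
  free-∪⁅⁆ (w∉R , w∉S) w≢v = w∉R , ∉-∪⁅⁆ w∉S w≢v

  injective⇒∃∉ : ∀ {k} (q : Fin k → Fin N) → Injective _≡_ _≡_ q →
        (L : List (Fin N)) → length L < k → ∃ λ i → q i ∉ₗ L
  injective⇒∃∉ {k} q q-injective L short with all? (λ i → q i ∈ₗ? L)
  ... | yes all∈ = ⊥-elim (<⇒≱ short (injective⇒≤length q q-injective all∈))
  ... | no ¬all = ¬∀⟶∃¬ k _ (λ i → q i ∈ₗ? L) ¬all

Least : (ℕ → Set) → ℕ → Set
Least P j = P j × (∀ i → i < j → ¬ P i)

least : ∀ {P : ℕ → Set} → Decidable P → ∀ {k} → P k → ∃ (Least P)
least {P} P? {k} = <-rec (λ k → P k → ∃ (Least P)) search k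
  where
  search : ∀ k → (∀ {j} → j < k → P j → ∃ (Least P)) → P k → ∃ (Least P)
  search k smaller pk with anyUpTo? P? k
  ... | yes (j , j<k , pj) = smaller j<k pj
  ... | no none = k , pk , λ i i<k pi → none (i , i<k , pi)

module Distance {N : ℕ} (X : Graph N) where

  walk? : ∀ x y k → Dec (Walk X x y k)
  walk? x y zero with x ≟ y
  ... | yes refl = yes here
  ... | no x≢y = no λ { here → x≢y refl }
  walk? x y (suc k) with any? (λ w → E-dec X x w ×-dec walk? w y k)
  ... | yes (w , e , walk) = yes (step e walk)
  ... | no none = no λ { (step e walk) → none (_ , e , walk) }

  dist : Connected X → ∀ x y → ∃ (Dist X x y)
  dist connected x y = least (walk? x y) (proj₂ (connected x y))

  dist-refl : ∀ x → Dist X x x 0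
  dist-refl x = here , λ _ ()

  dist≡0⇒≡ : ∀ {x y} → Dist X x y 0 → x ≡ y
  dist≡0⇒≡ (here , _) = refl

  dist≤walk : ∀ {x y a k} → Dist X x y a → Walk X x y k → a ≤ k
  dist≤walk {k = k} (_ , shortest) walk = ≮⇒≥ λ k<a → shortest k k<a walk

  dist-edge : ∀ {x y a} → x ≢ y → E X x y → Dist X x y a → a ≡ 1
  dist-edge {a = zero}        x≢y _ d = ⊥-elim (x≢y (dist≡0⇒≡ d))
  dist-edge {a = suc zero}    _   _ _ = refl
  dist-edge {a = suc (suc a)} _   e d with dist≤walk d (step e here)
  ... | s≤s ()

  ¬edge⇒dist≢1 : ∀ {x y b} → ¬ E X x y → Dist X x y b → b ≢ 1
  ¬edge⇒dist≢1 ¬e (step e here , _) refl = ¬e e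

  _≼_ : Fin N → Fin N → Set
  p ≼ q = ∀ w → w ≢ p → w ≢ q → E X p w → E X q w

  ≼⇒dist≥ : ∀ {p q z a b} → p ≼ q → z ≢ p → Dist X p z a → Dist X q z b → b ≤ a
  ≼⇒dist≥ _ z≢p (here , _) _ = ⊥-elim (z≢p refl)
  ≼⇒dist≥ {p} {q} p≼q _ (step {y = w} e rest , _) dq with w ≟ q
  ... | yes refl = ≤-trans (dist≤walk dq rest) (n≤1+n _)
  ... | no w≢q = dist≤walk dq (step (p≼q w (λ { refl → E-irr X p e }) w≢q e) rest)

  Resolves : Subset N → Fin N → Fin N → Set
  Resolves W x y =
    Σ (Fin N) λ z → z ∈ W × Σ ℕ λ a → Σ ℕ λ b → Dist X x z a × Dist X y z b × a ≢ b

  resolves-sym : ∀ {W x y} → Resolves W y x → Resolves W x y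
  resolves-sym (z , z∈W , a , b , da , db , a≢b) = z , z∈W , b , a , db , da , ≢-sym a≢b

  resolves-member : Connected X → ∀ {W x y} → x ∈ W → x ≢ y → Resolves W x y
  resolves-member connected {x = x} {y} x∈W x≢y with dist connected y x
  ... | zero  , d = ⊥-elim (x≢y (sym (dist≡0⇒≡ d)))
  ... | suc b , d = x , x∈W , 0 , suc b , dist-refl x , d , λ ()

  resolves-edge : Connected X → ∀ {W x y z} → z ∈ W → x ≢ z → E X x z → ¬ E X y z → Resolves W x y
  resolves-edge connected {x = x} {y} {z} z∈W x≢z e ¬e with dist connected x z | dist connected y z
  ... | a , da | b , db =
    z , z∈W , a , b , da , db , λ a≡b → ¬edge⇒dist≢1 ¬e db (trans (sym a≡b) (dist-edge x≢z e da))

  resolving-meets-twins : ∀ {p q W} → p ≼ q → q ≼ p → p ≢ q → Resolving X W → p ∈ W ⊎ q ∈ W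
  resolving-meets-twins {p} {q} p≼q q≼p p≢q resolving with resolving p q p≢q
  ... | z , z∈W , a , b , da , db , a≢b with z ≟ p | z ≟ q
  ...   | yes refl | _        = inj₁ z∈W
  ...   | no _     | yes refl = inj₂ z∈W
  ...   | no z≢p   | no z≢q   =
    ⊥-elim (a≢b (≤-antisym (≼⇒dist≥ q≼p z≢q db da) (≼⇒dist≥ p≼q z≢p da db)))

  ∁-resolving : Connected X → ∀ {S} → Subsingleton S → Resolving X (∁ S)
  ∁-resolving connected {S} subsingleton x y x≢y with x ∈? S | y ∈? S
  ... | no x∉S  | _       = resolves-member connected (x∉p⇒x∈∁p x∉S) x≢y
  ... | yes _   | no y∉S  = resolves-sym (resolves-member connected (x∉p⇒x∈∁p y∉S) (≢-sym x≢y))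
  ... | yes x∈S | yes y∈S = ⊥-elim (x≢y (subsingleton x∈S y∈S))

module Play {N : ℕ} (X : Graph N) where

  open Distance X

  ResolvingWithin : ℕ → Subset N → Set
  ResolvingWithin k R = Σ (List (Fin N)) λ L → length L ≤ k ×
    Σ (Subset N) λ W → Resolving X W × (∀ {x} → x ∈ W → x ∈ R ⊎ x ∈ₗ L)

  resolving⇒resolvingWithin : ∀ {k R} → Resolving X R → ResolvingWithin k R
  resolving⇒resolvingWithin {R = R} resolving = [] , z≤n , R , resolving , inj₁

  resolvingWithin-∪⁅⁆ : ∀ {k R w} → ResolvingWithin k (R ∪ ⁅ w ⁆) → ResolvingWithin (suc k) R
  resolvingWithin-∪⁅⁆ {w = w} (L , len , W , resolving , W⊆) = w ∷ L , s≤s len , W , resolving , W⊆′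
    where
    W⊆′ : ∀ {x} → x ∈ W → _ ⊎ x ∈ₗ w ∷ L
    W⊆′ x∈W with W⊆ x∈W
    ... | inj₂ x∈L = inj₂ (Any.there x∈L)
    ... | inj₁ x∈R∪w with ∈-∪⁅⁆⁻ x∈R∪w
    ...   | inj₁ x∈R = inj₁ x∈R
    ...   | inj₂ x≡w = inj₂ (Any.here x≡w)

  mutual
    resWinR⇒resolvingWithin : ∀ k {R S} → ResWinR X k R S → ResolvingWithin k R
    resWinR⇒resolvingWithin zero    resolving            = resolving⇒resolvingWithin resolving
    resWinR⇒resolvingWithin (suc k) (inj₁ resolving)     = resolving⇒resolvingWithin resolving
    resWinR⇒resolvingWithin (suc k) (inj₂ (_ , _ , win)) =
      resolvingWithin-∪⁅⁆ (resWinS⇒resolvingWithin k win)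

    resWinS⇒resolvingWithin : ∀ k {R S} → ResWinS X k R S → ResolvingWithin k R
    resWinS⇒resolvingWithin k (inj₁ resolving)            = resolving⇒resolvingWithin resolving
    resWinS⇒resolvingWithin k (inj₂ ((v , v-free) , win)) = resWinR⇒resolvingWithin k (win v v-free)

  spoWinR-0⇒blocks : ∀ {R S} → SpoWinR X 0 R S → Blocks X S
  spoWinR-0⇒blocks (inj₁ blocks)                = blocks
  spoWinR-0⇒blocks (inj₂ ((v , v-free) , win)) = win v v-free

  ¬blocks-subsingleton : Connected X → ∀ {S} → Subsingleton S → ¬ Blocks X S
  ¬blocks-subsingleton connected subsingleton blocks
    with blocks _ (∁-resolving connected subsingleton)
  ... | v , v∈∁S , v∈S = x∈∁p⇒x∉p v∈∁S v∈S

  ¬spoWinS-1-from-⊥ : Connected X → ∀ {R} → ¬ SpoWinS X 1 R ⊥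
  ¬spoWinS-1-from-⊥ connected (inj₁ blocks) = ¬blocks-subsingleton connected ⊥-subsingleton blocks
  ¬spoWinS-1-from-⊥ connected (inj₂ (v , _ , win)) =
    ¬blocks-subsingleton connected (⊥∪⁅⁆-subsingleton v) (spoWinR-0⇒blocks win)

  ¬spoilerWinsIn-R-game-1 : Connected X → ¬ SpoilerWinsIn-R-game X 1
  ¬spoilerWinsIn-R-game-1 connected (inj₁ blocks) = ¬blocks-subsingleton connected ⊥-subsingleton blocks
  ¬spoilerWinsIn-R-game-1 connected (inj₂ ((v , v-free) , win)) = ¬spoWinS-1-from-⊥ connected (win v v-free)

  module FourTwins (q : Fin 4 → Fin N) (q-injective : Injective _≡_ _≡_ q)
                   (q-twins : ∀ i j → q i ≼ q j) where

    blocks : ∀ {i j S} → i ≢ j → q i ∈ S → q j ∈ S → Blocks X S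
    blocks {i} {j} i≢j qi∈S qj∈S W resolving
      with resolving-meets-twins (q-twins i j) (q-twins j i) (i≢j ∘ q-injective) resolving
    ... | inj₁ qi∈W = q i , qi∈W , qi∈S
    ... | inj₂ qj∈W = q j , qj∈W , qj∈S

    last-move : ∀ {i L R S} → q i ∈ S → Claimed L R S → length L < 4 → SpoWinS X 1 R S
    last-move {i} {L} {S = S} qi∈S claimed short with injective⇒∃∉ q q-injective L short
    ... | j , qj∉L = inj₂ (q j , unclaimed⇒free claimed qj∉L ,
                           inj₁ (blocks i≢j (x∈p∪q⁺ (inj₁ qi∈S)) (∈-∪⁅⁆ S (q j))))
      where
      i≢j : i ≢ j
      i≢j refl = qj∉L (claimed (inj₂ qi∈S))

    answer : ∀ {i L R S} → q i ∈ S → Claimed L R S → length L < 3 → SpoWinR X 1 R S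
    answer qi∈S claimed short with injective⇒∃∉ q q-injective _ (m≤n⇒m≤1+n short)
    ... | j , qj∉L = inj₂ ((q j , unclaimed⇒free claimed qj∉L) ,
                           λ w _ → last-move qi∈S (claimed-R claimed) (s≤s short))

    first-move : ∀ {L R S} → Claimed L R S → length L < 2 → SpoWinS X 2 R S
    first-move {S = S} claimed short with injective⇒∃∉ q q-injective _ (m≤n⇒m≤1+n (m≤n⇒m≤1+n short))
    ... | i , qi∉L = inj₂ (q i , unclaimed⇒free claimed qi∉L ,
                           answer (∈-∪⁅⁆ S (q i)) (claimed-S claimed) (s≤s short))

    spoilerWinsIn-S-game : SpoilerWinsIn-S-game X 2
    spoilerWinsIn-S-game = first-move claimed-⊥ (s≤s z≤n)

    spoilerWinsIn-R-game : SpoilerWinsIn-R-game X 2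
    spoilerWinsIn-R-game =
      inj₂ ((q 0F , ∉⊥ , ∉⊥) , λ x _ → first-move (claimed-R claimed-⊥) (s≤s (s≤s z≤n)))

module Pairs {n : ℕ} where

  base : Fin (n * 2) → Fin n
  base = fstV {n} 2

  bit : Fin (n * 2) → Fin 2
  bit = sndV {n} 2

  base-combine : ∀ g a → base (combine g a) ≡ g
  base-combine g a = cong proj₁ (remQuot-combine {n} {2} g a)

  bit-combine : ∀ g a → bit (combine g a) ≡ a
  bit-combine g a = cong proj₂ (remQuot-combine {n} {2} g a)

  combine-base-bit : ∀ x → combine (base x) (bit x) ≡ x
  combine-base-bit = combine-remQuot {n} 2

  base-bit-injective : ∀ {x y} → base x ≡ base y → bit x ≡ bit y → x ≡ y
  base-bit-injective {x} {y} same-base same-bit = begin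
    x                          ≡⟨ combine-base-bit x ⟨
    combine (base x) (bit x)   ≡⟨ cong₂ combine same-base same-bit ⟩
    combine (base y) (bit y)   ≡⟨ combine-base-bit y ⟩
    y                          ∎
    where open ≡-Reasoning

  Hit : Subset (n * 2) → Fin n → Set
  Hit R g = ∃ λ a → combine g a ∈ R

  hit? : ∀ R g → Dec (Hit R g)
  hit? R g = any? λ a → combine g a ∈? R

  hit-∪ : ∀ {R g} P → Hit R g → Hit (R ∪ P) g
  hit-∪ P (a , a∈R) = a , x∈p∪q⁺ (inj₁ a∈R)

  all-hit-or-unhit : ∀ R → (∀ g → Hit R g) ⊎ ∃ λ g → ¬ Hit R g
  all-hit-or-unhit R with all? (hit? R)
  ... | yes all-hit = inj₁ all-hit
  ... | no ¬all-hit = inj₂ (¬∀⟶∃¬ n _ (hit? R) ¬all-hit)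

  hit-pair⇒member : ∀ {R x y} → base x ≡ base y → x ≢ y → Hit R (base x) → x ∈ R ⊎ y ∈ R
  hit-pair⇒member {R} {x} {y} same-base x≢y (a , a∈R) with fin2-cases (x≢y ∘ base-bit-injective same-base) a
  ... | inj₁ refl = inj₁ (subst (_∈ R) (combine-base-bit x) a∈R)
  ... | inj₂ refl =
    inj₂ (subst (_∈ R) (trans (cong (λ g → combine g (bit y)) same-base) (combine-base-bit y)) a∈R)

  resolver-needs-n-moves : ∀ {X : Graph (n * 2)} {k} → (∀ W → Resolving X W → ∀ g → Hit W g) →
                           Play.ResolvingWithin X k ⊥ → n ≤ k
  resolver-needs-n-moves hits (L , len , W , resolving , W⊆) =
    ≤-trans (injective⇒≤length hit-in-L injective in-L) len
    where
    hit-in-L : Fin n → Fin (n * 2)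
    hit-in-L g = combine g (proj₁ (hits W resolving g))
    injective : Injective _≡_ _≡_ hit-in-L
    injective same = combine-injectiveˡ _ _ _ _ same
    in-L : ∀ g → hit-in-L g ∈ₗ L
    in-L g with W⊆ (proj₂ (hits W resolving g))
    ... | inj₁ ∈⊥ = ⊥-elim (∉⊥ ∈⊥)
    ... | inj₂ ∈L = ∈L

  module PairingStrategy (X : Graph (n * 2)) (hitting-resolves : ∀ R → (∀ g → Hit R g) → Resolving X R) where

    Untouched : Subset (n * 2) → Subset (n * 2) → Fin n → Set
    Untouched R S g = ∀ a → Free R S (combine g a)

    PairingPosition : ℕ → Subset (n * 2) → Subset (n * 2) → Set
    PairingPosition k R S =
      Σ (List (Fin n)) λ U → length U ≤ k × (∀ g → Hit R g ⊎ (g ∈ₗ U × Untouched R S g))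

    untouched : ∀ {k R S g} → PairingPosition k R S → ¬ Hit R g → Untouched R S g
    untouched {g = g} (_ , _ , inv) unhit with inv g
    ... | inj₁ hit = ⊥-elim (unhit hit)
    ... | inj₂ (_ , g-untouched) = g-untouched

    position-0-all-hit : ∀ {R S} → PairingPosition 0 R S → ∀ g → Hit R g
    position-0-all-hit ([] , _ , inv) g with inv g
    ... | inj₁ hit = hit
    ... | inj₂ (() , _)

    advance : ∀ {k R S S′ g a} → PairingPosition (suc k) R S → ¬ Hit R g → Free R S′ (combine g a) →
              (∀ {h b} → ¬ Hit (R ∪ ⁅ combine g a ⁆) h → combine h b ∉ S → combine h b ∉ S′) →
              PairingPosition k (R ∪ ⁅ combine g a ⁆) S′
    advance {k} {R} {S} {S′} {g} {a} (U , len , inv) g-unhit w-free stays-free = filter ≢g? U , shorter , inv′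
      where
      ≢g? : Decidable (_≢ g)
      ≢g? h = ¬? (h ≟ g)
      g∈U : g ∈ₗ U
      g∈U with inv g
      ... | inj₁ hit = ⊥-elim (g-unhit hit)
      ... | inj₂ (g∈U , _) = g∈U
      shorter : length (filter ≢g? U) ≤ k
      shorter = ≤-pred (<-≤-trans (filter-notAll ≢g? U (Any.map (λ g≡h h≢g → h≢g (sym g≡h)) g∈U)) len)
      inv′ : ∀ h → Hit (R ∪ ⁅ combine g a ⁆) h
                 ⊎ (h ∈ₗ filter ≢g? U × Untouched (R ∪ ⁅ combine g a ⁆) S′ h)
      inv′ h with hit? (R ∪ ⁅ combine g a ⁆) h
      ... | yes hit = inj₁ hit
      ... | no unhit with inv h
      ...   | inj₁ hit = ⊥-elim (unhit (hit-∪ _ hit))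
      ...   | inj₂ (h∈U , h-untouched) = inj₂ (∈-filter⁺ ≢g? h∈U h≢g , still-untouched)
        where
        h≢g : h ≢ g
        h≢g refl = unhit (a , ∈-∪⁅⁆ R (combine g a))
        still-untouched : Untouched (R ∪ ⁅ combine g a ⁆) S′ h
        still-untouched b = ∉-∪⁅⁆ (proj₁ (h-untouched b)) (h≢g ∘ combine-injectiveˡ _ _ _ _)
                          , stays-free unhit (proj₂ (h-untouched b))

    covered-stays-free : ∀ {R S v h b} → Hit R (base v) → ¬ Hit R h →
                         combine h b ∉ S → combine h b ∉ S ∪ ⁅ v ⁆
    covered-stays-free {R} v-covered h-unhit ∉S =
      ∉-∪⁅⁆ ∉S λ { refl → h-unhit (subst (Hit R) (base-combine _ _) v-covered) }

    Reply : Subset (n * 2) → Subset (n * 2) → Fin (n * 2) → Fin n → Fin 2 → Set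
    Reply R S v g a = ¬ Hit R g × Free R (S ∪ ⁅ v ⁆) (combine g a) × Hit (R ∪ ⁅ combine g a ⁆) (base v)

    -- If Spoiler's v lies in an unhit pair, take its partner; otherwise hit any unhit pair g₀.
    -- Either way v ends up in a hit pair, so all unhit pairs stay untouched.
    reply : ∀ {k R S g₀} v → PairingPosition k R S → ¬ Hit R g₀ → ∃₂ (Reply R S v)
    reply {R = R} {g₀ = g₀} v pos g₀-unhit with hit? R (base v)
    ... | yes v-hit = g₀ , 0F , g₀-unhit , free-∪⁅⁆ (untouched pos g₀-unhit 0F) w≢v , hit-∪ _ v-hit
      where
      w≢v : combine g₀ 0F ≢ v
      w≢v refl = g₀-unhit (subst (Hit R) (base-combine g₀ 0F) v-hit)
    ... | no v-unhit = base v , opposite (bit v) , v-unhit , free-∪⁅⁆ (untouched pos v-unhit _) w≢v ,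
                       opposite (bit v) , ∈-∪⁅⁆ R _
      where
      w≢v : combine (base v) (opposite (bit v)) ≢ v
      w≢v w≡v = opposite-≢ (bit v) (trans (sym (bit-combine _ _)) (cong bit w≡v))

    resolverWins-S : ∀ k {R S} → PairingPosition k R S → ResWinS X k R S
    resolverWins-S zero pos = inj₁ (hitting-resolves _ (position-0-all-hit pos))
    resolverWins-S (suc k) {R} {S} pos with all-hit-or-unhit R
    ... | inj₁ all-hit = inj₁ (hitting-resolves R all-hit)
    ... | inj₂ (g₀ , g₀-unhit) = inj₂ ((combine g₀ 0F , untouched pos g₀-unhit 0F) , respond)
      where
      respond : ∀ v → Free R S v → ResWinR X (suc k) R (S ∪ ⁅ v ⁆)
      respond v _ with reply v pos g₀-unhit
      ... | g , a , g-unhit , w-free , v-covered =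
        inj₂ (combine g a , w-free , resolverWins-S k (advance pos g-unhit w-free (covered-stays-free v-covered)))

    resolverWins-R : ∀ k {R S} → PairingPosition k R S → ResWinR X k R S
    resolverWins-R zero pos = hitting-resolves _ (position-0-all-hit pos)
    resolverWins-R (suc k) {R} {S} pos with all-hit-or-unhit R
    ... | inj₁ all-hit = inj₁ (hitting-resolves R all-hit)
    ... | inj₂ (g₀ , g₀-unhit) =
      inj₂ (combine g₀ 0F , w-free , resolverWins-S k (advance pos g₀-unhit w-free λ _ ∉S → ∉S))
      where
      w-free : Free R S (combine g₀ 0F)
      w-free = untouched pos g₀-unhit 0F

    initial : PairingPosition n ⊥ ⊥
    initial = allFin n , ≤-reflexive (length-tabulate _) , λ g → inj₂ (∈-allFin g , λ _ → ∉⊥ , ∉⊥)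

    resolverWinsIn-R-game : ResolverWinsIn-R-game X n
    resolverWinsIn-R-game = resolverWins-R n initial

    resolverWinsIn-S-game : ResolverWinsIn-S-game X n
    resolverWinsIn-S-game = resolverWins-S n initial

module ClosedNeighbourhood {n : ℕ} (G : Graph n) where

  _∈N[_] : Fin n → Fin n → Set
  w ∈N[ g ] = w ≡ g ⊎ E G g w

  _∈N?[_] : ∀ w g → Dec (w ∈N[ g ])
  w ∈N?[ g ] = (w ≟ g) ⊎-dec E-dec G g w

  N[_]⊆N[_] : Fin n → Fin n → Set
  N[ g ]⊆N[ h ] = ∀ w → w ∈N[ g ] → w ∈N[ h ]

  N[_]⊆?N[_] : ∀ g h → Dec (N[ g ]⊆N[ h ])
  N[ g ]⊆?N[ h ] = all? λ w → w ∈N?[ g ] →-dec w ∈N?[ h ]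

  N-refl : ∀ {g h} → g ≡ h → N[ g ]⊆N[ h ]
  N-refl refl _ w∈N = w∈N

  ⊈⇒separating : ∀ {g h} → ¬ N[ g ]⊆N[ h ] → ∃ λ w → w ∈N[ g ] × ¬ w ∈N[ h ]
  ⊈⇒separating {g} {h} g⊈h with ¬∀⟶∃¬ n _ (λ w → w ∈N?[ g ] →-dec w ∈N?[ h ]) g⊈h
  ... | w , ¬inclusion with w ∈N?[ g ]
  ...   | yes w∈Ng = w , w∈Ng , λ w∈Nh → ¬inclusion λ _ → w∈Nh
  ...   | no w∉Ng = ⊥-elim (¬inclusion λ w∈Ng → ⊥-elim (w∉Ng w∈Ng))

  twin⇒N⊆ : ∀ {u v} → E G u v → (∀ w → E G u w × w ≢ v → E G v w × w ≢ u) → N[ u ]⊆N[ v ]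
  twin⇒N⊆ euv _ _ (inj₁ refl) = inj₂ (E-sym G euv)
  twin⇒N⊆ {v = v} _ twin w (inj₂ euw) with w ≟ v
  ... | yes w≡v = inj₁ w≡v
  ... | no w≢v = inj₂ (proj₁ (twin w (euw , w≢v)))

  N⊆⇒twin : ∀ {g h} → N[ g ]⊆N[ h ] → ∀ w → E G g w × w ≢ h → E G h w × w ≢ g
  N⊆⇒twin g⊆h w (egw , w≢h) with g⊆h w (inj₂ egw)
  ... | inj₁ w≡h = ⊥-elim (w≢h w≡h)
  ... | inj₂ ehw = ehw , λ { refl → E-irr G w egw }

  trueTwins⇒sameN : HasTrueTwins G → ∃₂ λ u v → u ≢ v × N[ u ]⊆N[ v ] × N[ v ]⊆N[ u ]
  trueTwins⇒sameN (u , v , u≢v , euv , twin) =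
    u , v , u≢v , twin⇒N⊆ euv (λ w → Equivalence.to (twin w))
                , twin⇒N⊆ (E-sym G euv) (λ w → Equivalence.from (twin w))

  sameN⇒trueTwins : ∀ {g h} → g ≢ h → N[ g ]⊆N[ h ] → N[ h ]⊆N[ g ] → HasTrueTwins G
  sameN⇒trueTwins {g} {h} g≢h g⊆h h⊆g =
    g , h , g≢h , egh , λ w → mk⇔ (N⊆⇒twin g⊆h w) (N⊆⇒twin h⊆g w)
    where
    egh : E G g h
    egh with h⊆g h (inj₁ refl)
    ... | inj₁ h≡g = ⊥-elim (g≢h (sym h≡g))
    ... | inj₂ egh = egh

  hasTrueTwins? : Dec (HasTrueTwins G)
  hasTrueTwins? =
    map′ (λ { (u , v , u≢v , u⊆v , v⊆u) → sameN⇒trueTwins u≢v u⊆v v⊆u }) trueTwins⇒sameN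
    (any? λ u → any? λ v → ¬? (u ≟ v) ×-dec N[ u ]⊆?N[ v ] ×-dec N[ v ]⊆?N[ u ])

  separating-vertex : ¬ HasTrueTwins G → ∀ {g h} → g ≢ h →
                      ∃ λ w → (w ∈N[ g ] × ¬ w ∈N[ h ]) ⊎ (w ∈N[ h ] × ¬ w ∈N[ g ])
  separating-vertex ¬twins {g} {h} g≢h with N[ g ]⊆?N[ h ] | N[ h ]⊆?N[ g ]
  ... | no g⊈h  | _       = map₂ inj₁ (⊈⇒separating g⊈h)
  ... | yes _   | no h⊈g  = map₂ inj₂ (⊈⇒separating h⊈g)
  ... | yes g⊆h | yes h⊆g = ⊥-elim (¬twins (sameN⇒trueTwins g≢h g⊆h h⊆g))

module LexK₂ {n : ℕ} (G : Graph n) (G-connected : Connected G) where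

  open Pairs {n}
  open ClosedNeighbourhood G

  X : Graph (n * 2)
  X = G ∘ᴳ K₂

  open Distance X
  open Play X

  lex-edge⁻ : ∀ {x z} → E X x z → base z ∈N[ base x ]
  lex-edge⁻ (inj₁ e)          = inj₂ e
  lex-edge⁻ (inj₂ (same , _)) = inj₁ (sym same)

  lex-edge⁺ : ∀ {x z} → x ≢ z → base z ∈N[ base x ] → E X x z
  lex-edge⁺ _   (inj₂ e)    = inj₁ e
  lex-edge⁺ x≢z (inj₁ same) = inj₂ (sym same , x≢z ∘ base-bit-injective (sym same))

  walk-lift : ∀ {g h k x y} → Walk G g h k → base x ≡ g → base y ≡ h → ∃ (Walk X x y)
  walk-lift {x = x} {y} here refl y-over with x ≟ y
  ... | yes refl = 0 , here
  ... | no x≢y   = 1 , step (lex-edge⁺ x≢y (inj₁ y-over)) here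
  walk-lift (step {y = g′} e walk) refl y-over =
    map suc (step (inj₁ (subst (E G _) (sym (base-combine g′ 0F)) e)))
        (walk-lift walk (base-combine g′ 0F) y-over)

  X-connected : Connected X
  X-connected x y = walk-lift (proj₂ (G-connected (base x) (base y))) refl refl

  lex-≼ : ∀ {x y} → N[ base x ]⊆N[ base y ] → x ≼ y
  lex-≼ x⊆y w w≢x w≢y e = lex-edge⁺ (≢-sym w≢y) (x⊆y _ (lex-edge⁻ e))

  resolving-hits-pairs : ∀ W → Resolving X W → ∀ g → Hit W g
  resolving-hits-pairs W resolving g
    with resolving-meets-twins (lex-≼ (N-refl same)) (lex-≼ (N-refl (sym same))) distinct resolving
    where
    same : base (combine g 0F) ≡ base (combine g 1F)
    same = trans (base-combine g 0F) (sym (base-combine g 1F))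
    distinct : combine g 0F ≢ combine g 1F
    distinct = (λ ()) ∘ combine-injectiveʳ g 0F g 1F
  ... | inj₁ ∈W = 0F , ∈W
  ... | inj₂ ∈W = 1F , ∈W

  resolves-by-separator : ∀ {R x y w} → x ∉ R → Hit R w →
                          w ∈N[ base x ] → ¬ w ∈N[ base y ] → Resolves R x y
  resolves-by-separator {x = x} {y} x∉R (a , z∈R) w∈Nx w∉Ny =
    resolves-edge X-connected z∈R (λ { refl → x∉R z∈R })
      (lex-edge⁺ (λ { refl → x∉R z∈R }) (subst (_∈N[ base x ]) (sym (base-combine _ a)) w∈Nx))
      (w∉Ny ∘ subst (_∈N[ base y ]) (base-combine _ a) ∘ lex-edge⁻)

  hitting-resolves : ¬ HasTrueTwins G → ∀ R → (∀ g → Hit R g) → Resolving X R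
  hitting-resolves ¬twins R hits x y x≢y with x ∈? R | y ∈? R
  ... | yes x∈R | _       = resolves-member X-connected x∈R x≢y
  ... | no _    | yes y∈R = resolves-sym (resolves-member X-connected y∈R (≢-sym x≢y))
  ... | no x∉R  | no y∉R with base x ≟ base y
  ...   | yes same = ⊥-elim ([ x∉R , y∉R ] (hit-pair⇒member same x≢y (hits (base x))))
  ...   | no differ with separating-vertex ¬twins differ
  ...     | w , inj₁ (w∈Nx , w∉Ny) = resolves-by-separator x∉R (hits w) w∈Nx w∉Ny
  ...     | w , inj₂ (w∈Ny , w∉Nx) = resolves-sym (resolves-by-separator y∉R (hits w) w∈Ny w∉Nx)

  module TrueTwinQuadruple {u v} (u≢v : u ≢ v) (u⊆v : N[ u ]⊆N[ v ]) (v⊆u : N[ v ]⊆N[ u ]) where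

    twin : Fin 2 → Fin n
    twin 0F = u
    twin 1F = v

    twin-injective : Injective _≡_ _≡_ twin
    twin-injective {0F} {0F} _   = refl
    twin-injective {0F} {1F} u≡v = ⊥-elim (u≢v u≡v)
    twin-injective {1F} {0F} v≡u = ⊥-elim (u≢v (sym v≡u))
    twin-injective {1F} {1F} _   = refl

    twin-N⊆ : ∀ a b → N[ twin a ]⊆N[ twin b ]
    twin-N⊆ 0F 0F = N-refl refl
    twin-N⊆ 0F 1F = u⊆v
    twin-N⊆ 1F 0F = v⊆u
    twin-N⊆ 1F 1F = N-refl refl

    quadruple : Fin 4 → Fin (n * 2)
    quadruple i = combine (twin (quotient {2} 2 i)) (remainder {2} 2 i)

    quadruple-injective : Injective _≡_ _≡_ quadruple
    quadruple-injective same = Pairs.base-bit-injective {2}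
      (twin-injective (combine-injectiveˡ {n} {2} _ _ _ _ same)) (combine-injectiveʳ {n} {2} _ _ _ _ same)

    quadruple-twins : ∀ i j → quadruple i ≼ quadruple j
    quadruple-twins i j =
      lex-≼ (subst₂ N[_]⊆N[_] (sym (base-combine _ _)) (sym (base-combine _ _)) (twin-N⊆ _ _))

    open FourTwins quadruple quadruple-injective quadruple-twins public
      using (spoilerWinsIn-R-game; spoilerWinsIn-S-game)

  spoiler-wins-with-true-twins : HasTrueTwins G → SpoilerWinsIn-R-game X 2 × SpoilerWinsIn-S-game X 2
  spoiler-wins-with-true-twins twins with trueTwins⇒sameN twins
  ... | _ , _ , u≢v , u⊆v , v⊆u = spoilerWinsIn-R-game , spoilerWinsIn-S-game
    where open TrueTwinQuadruple u≢v u⊆v v⊆u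

  resolver-wins-without-true-twins : ¬ HasTrueTwins G → ResolverWinsIn-R-game X n × ResolverWinsIn-S-game X n
  resolver-wins-without-true-twins ¬twins = resolverWinsIn-R-game , resolverWinsIn-S-game
    where open PairingStrategy X (hitting-resolves ¬twins)

  resolver-needs-n-in-R-game : ∀ {k} → ResolverWinsIn-R-game X k → n ≤ k
  resolver-needs-n-in-R-game win = resolver-needs-n-moves resolving-hits-pairs (resWinR⇒resolvingWithin _ win)

  resolver-needs-n-in-S-game : ∀ {k} → ResolverWinsIn-S-game X k → n ≤ k
  resolver-needs-n-in-S-game win = resolver-needs-n-moves resolving-hits-pairs (resWinS⇒resolvingWithin _ win)

isMin-suc : ∀ {P : ℕ → Set} {m} → P (suc m) → (∀ {k} → P k → suc m ≤ k) → IsMin P (suc m)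
isMin-suc win lower = win , 1+n≰n ∘ lower

theorem4p2 : ∀ {n} (G : Graph n) → 2 ≤ n → Connected G →
    (HasOutcome (G ∘ᴳ K₂) 𝓡 ⊎ HasOutcome (G ∘ᴳ K₂) 𝓢)
    × (HasTrueTwins G → S-MB (G ∘ᴳ K₂) 2 × S-MB′ (G ∘ᴳ K₂) 2)
    × (¬ HasTrueTwins G → R-MB (G ∘ᴳ K₂) (nV G) × R-MB′ (G ∘ᴳ K₂) (nV G))
theorem4p2 G (s≤s _) G-connected = outcome , twins-case , no-twins-case
  where
  open LexK₂ G G-connected
  open Play X using (¬spoilerWinsIn-R-game-1; ¬spoWinS-1-from-⊥)

  twins-case : HasTrueTwins G → S-MB X 2 × S-MB′ X 2
  twins-case twins = (proj₁ wins , ¬spoilerWinsIn-R-game-1 X-connected)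
                   , (proj₂ wins , ¬spoWinS-1-from-⊥ X-connected)
    where
    wins : SpoilerWinsIn-R-game X 2 × SpoilerWinsIn-S-game X 2
    wins = spoiler-wins-with-true-twins twins

  no-twins-case : ¬ HasTrueTwins G → R-MB X (nV G) × R-MB′ X (nV G)
  no-twins-case ¬twins = isMin-suc (proj₁ wins) resolver-needs-n-in-R-game
                       , isMin-suc (proj₂ wins) resolver-needs-n-in-S-game
    where
    wins : ResolverWinsIn-R-game X (nV G) × ResolverWinsIn-S-game X (nV G)
    wins = resolver-wins-without-true-twins ¬twins

  outcome : HasOutcome X 𝓡 ⊎ HasOutcome X 𝓢
  outcome with ClosedNeighbourhood.hasTrueTwins? G
  ... | yes twins = inj₂ (map (2 ,_) (2 ,_) (spoiler-wins-with-true-twins twins))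
  ... | no ¬twins = inj₁ (map (_ ,_) (_ ,_) (resolver-wins-without-true-twins ¬twins))
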